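{- Let integers $a,x$ satisfy $3\le a\le x$, let $\lambda=(x,x,ax)$, $n=x(a+2)$, and suppose $n-1$ is coprime to both $a$ and $x$. For $1\le i\le n-2$ write $i=(a+2)r_i+p_i$ with $0\le p_i<a+2$, let $f(i)=ar_i-(2x-1)p_i$, and for $s\in\mathbb{Z}$ let $F_s=\{i\in\{1,\dots,n-2\}: s=-\lfloor f(i)/(n-1)\rfloor\}$. Then for every $1\le i\le n-2$ and $s\in\mathbb{Z}$, $i\in F_s$ if and only if $n-1-i\in F_{2-s}$. -}

module Defs where

open import Data.Nat as ℕ using (ℕ; suc; _∸_)
open import Data.Integer as ℤ using (ℤ; +_; _-_; -_)
open import Data.Product using (_×_)
open import Relation.Binary.PropositionalEquality using (_≡_)

-- The stdlib's ℤ._/ℕ_ rounds toward minus infinity (Euclidean division by a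
-- positive divisor), i.e. it is exactly the floor.
⌊_/suc_⌋ : ℤ → ℕ → ℤ
⌊ m /suc k ⌋ = m ℤ./ℕ suc k

nOf : ℕ → ℕ → ℕ
nOf a x = x ℕ.* (a ℕ.+ 2)

r : ℕ → ℕ → ℕ
r a i = i ℕ./ (2 ℕ.+ a)

p : ℕ → ℕ → ℕ
p a i = i ℕ.% (2 ℕ.+ a)

f : ℕ → ℕ → ℕ → ℤ
f a x i = + (a ℕ.* r a i) - + ((2 ℕ.* x ∸ 1) ℕ.* p a i)

-- i ∈ F_s  iff  1 ≤ i ≤ n-2  and  s = - ⌊ f(i) / (n-1) ⌋.
-- The divisor n - 1 is written as suc (n ∸ 2), valid since n ≥ 15.
InF : ℕ → ℕ → ℤ → ℕ → Set
InF a x s i = (1 ℕ.≤ i) × (i ℕ.≤ nOf a x ∸ 2) × (s ≡ - ⌊ f a x i /suc (nOf a x ∸ 2) ⌋)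

-- Write n = x(a+2) and N = n - 1.  Since i ↦ N - i exchanges the base-(a+2) digits
-- (p, r) of i with (a+1-p, x-1-r), a ring identity gives f(i) + f(N-i) = -N.  Hence
-- ⌊f(N-i)/N⌋ = -⌊f(i)/N⌋ - 2, provided N does not divide f(i).  It does not: f(i) is
-- congruent to -(2x-1)i modulo N, 2x-1 is coprime to N whenever a is, and 0 < i < N.
module Submission where

open import Defs
open import Data.Nat as ℕ using (ℕ; _≤_; _∸_)
open import Data.Nat.Coprimality using (Coprime; coprime-divisor)
open import Data.Integer as ℤ using (ℤ; +_; _-_)
open import Function.Bundles using (_⇔_; mk⇔; Equivalence)

open import Data.Nat.Base using (NonZero; suc; s≤s; z≤n; _<_)
import Data.Nat.Properties as ℕP
open import Data.Nat.DivMod using (_/_; _%_; m≡m%n+[m/n]*n; m%n<n; m<n*o⇒m/o<n)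
import Data.Nat.DivMod as ℕD
open import Data.Nat.Divisibility using (_∣_; divides; ∣⇒≤; ∣m+n∣m⇒∣n; ∣m⇒∣m*n; ∣n⇒∣m*n)
open import Data.Integer using (_+_; _*_; -_; _/ℕ_; _%ℕ_)
import Data.Integer.Properties as ℤP
open import Data.Integer.DivMod using (a≡a%ℕn+[a/ℕn]*n; n%ℕd<d; [n/ℕd]*d≤n; n<s[n/ℕd]*d)
open import Data.Integer.Tactic.RingSolver using (solve-∀)
open import Data.Nat.Tactic.RingSolver renaming (solve-∀ to ℕ-solve-∀)
open import Data.Product using (_×_; _,_; proj₁; proj₂)
open import Relation.Nullary using (contradiction)
open import Relation.Binary.PropositionalEquality
open import Relation.Binary.Definitions using (tri<; tri≈; tri>)

pos-∸ : ∀ {m n} → n ≤ m → + (m ∸ n) ≡ + m - + n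
pos-∸ {m} {n} n≤m = trans (sym (ℤP.⊖-≥ n≤m)) (sym (ℤP.m-n≡m⊖n m n))

/ℕ-unique : ∀ z t d .{{_ : NonZero d}} → t * + d ℤ.≤ z → z ℤ.< ℤ.suc t * + d → z /ℕ d ≡ t
/ℕ-unique z t d lo hi with ℤP.<-cmp t (z /ℕ d)
... | tri≈ _ t≡q _ = sym t≡q
... | tri< t<q _ _ = contradiction
  (ℤP.≤-trans (ℤP.*-monoʳ-≤-nonNeg (+ d) (ℤP.i<j⇒suc[i]≤j t<q)) ([n/ℕd]*d≤n z d)) (ℤP.<⇒≱ hi)
... | tri> _ _ q<t = contradiction
  (ℤP.≤-trans (ℤP.*-monoʳ-≤-nonNeg (+ d) (ℤP.i<j⇒suc[i]≤j q<t)) lo) (ℤP.<⇒≱ (n<s[n/ℕd]*d z d))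

[ρ+t*d]/ℕd≡t : ∀ ρ t d .{{_ : NonZero d}} → ρ < d → (+ ρ + t * + d) /ℕ d ≡ t
[ρ+t*d]/ℕd≡t ρ t d ρ<d = /ℕ-unique _ t d (ℤP.i≤j+i _ (+ ρ))
  (subst (+ ρ + t * + d ℤ.<_) (sym (ℤP.suc-* t (+ d))) (ℤP.+-monoˡ-< (t * + d) (ℤ.+<+ ρ<d)))

-- For d ∤ z, the remainder of -d - z is d minus that of z, which stays in (0, d).
/ℕ-reflect : ∀ z d .{{_ : NonZero d}} → z %ℕ d ≢ 0 → (- + d - z) /ℕ d ≡ - (z /ℕ d) - + 2
/ℕ-reflect z d z%d≢0 = begin
  (- + d - z) /ℕ d                                  ≡⟨ cong (_/ℕ d) rewritten ⟩
  (+ (d ∸ ρ) + (- q - + 2) * + d) /ℕ d              ≡⟨ [ρ+t*d]/ℕd≡t (d ∸ ρ) (- q - + 2) d d∸ρ<d ⟩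
  - q - + 2                                         ∎
  where
  open ≡-Reasoning
  ρ : ℕ
  ρ = z %ℕ d
  q : ℤ
  q = z /ℕ d
  ρ<d : ρ < d
  ρ<d = n%ℕd<d z d
  d∸ρ<d : d ∸ ρ < d
  d∸ρ<d = ℕP.∸-monoʳ-< (ℕP.n≢0⇒n>0 z%d≢0) (ℕP.<⇒≤ ρ<d)
  identity : ∀ D R Q → - D - (R + Q * D) ≡ (D - R) + (- Q - + 2) * D
  identity = solve-∀
  rewritten : - + d - z ≡ + (d ∸ ρ) + (- q - + 2) * + d
  rewritten = begin
    - + d - z                              ≡⟨ cong (λ v → - + d - v) (a≡a%ℕn+[a/ℕn]*n z d) ⟩
    - + d - (+ ρ + q * + d)                ≡⟨ identity (+ d) (+ ρ) q ⟩
    (+ d - + ρ) + (- q - + 2) * + d        ≡⟨ cong (_+ (- q - + 2) * + d) (sym (pos-∸ (ℕP.<⇒≤ ρ<d))) ⟩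
    + (d ∸ ρ) + (- q - + 2) * + d          ∎

[p+q*m]/m≡q×[p+q*m]%m≡p : ∀ {m} p q .{{_ : NonZero m}} → p < m →
  (p ℕ.+ q ℕ.* m) / m ≡ q × (p ℕ.+ q ℕ.* m) % m ≡ p
[p+q*m]/m≡q×[p+q*m]%m≡p {m} p q p<m = quotient , remainder
  where
  remainder : (p ℕ.+ q ℕ.* m) % m ≡ p
  remainder = trans (ℕD.[m+kn]%n≡m%n p q m) (ℕD.m<n⇒m%n≡m p<m)
  quotient : (p ℕ.+ q ℕ.* m) / m ≡ q
  quotient = begin
    (p ℕ.+ q ℕ.* m) / m      ≡⟨ ℕD.+-distrib-/ p (q ℕ.* m) (subst (_< m) (sym digit-sum) p<m) ⟩
    p / m ℕ.+ q ℕ.* m / m    ≡⟨ cong₂ ℕ._+_ (ℕD.m<n⇒m/n≡0 p<m) (ℕD.m*n/n≡m q m) ⟩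
    q                        ∎
    where
    open ≡-Reasoning
    digit-sum : p % m ℕ.+ q ℕ.* m % m ≡ p
    digit-sum = trans (cong₂ ℕ._+_ (ℕD.m<n⇒m%n≡m p<m) (ℕD.m*n%n≡0 q m)) (ℕP.+-identityʳ p)

∸-complement-digits : ∀ {m x p r} → p < m → r < x →
  x ℕ.* m ∸ 1 ∸ (p ℕ.+ r ℕ.* m) ≡ (m ∸ 1 ∸ p) ℕ.+ (x ∸ 1 ∸ r) ℕ.* m
∸-complement-digits {p = p} {r} p<m r<x
  with p′ , refl ← ℕP.m≤n⇒∃[o]m+o≡n p<m | r′ , refl ← ℕP.m≤n⇒∃[o]m+o≡n r<x = begin
    (suc r ℕ.+ r′) ℕ.* m ∸ 1 ∸ (p ℕ.+ r ℕ.* m)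
      ≡⟨ cong (λ v → v ∸ 1 ∸ (p ℕ.+ r ℕ.* m)) (split p p′ r r′) ⟩
    (p ℕ.+ r ℕ.* m) ℕ.+ (p′ ℕ.+ r′ ℕ.* m) ∸ (p ℕ.+ r ℕ.* m)
      ≡⟨ ℕP.m+n∸m≡n (p ℕ.+ r ℕ.* m) _ ⟩
    p′ ℕ.+ r′ ℕ.* m
      ≡⟨ cong₂ (λ u v → u ℕ.+ v ℕ.* m) (ℕP.m+n∸m≡n p p′) (ℕP.m+n∸m≡n r r′) ⟨
    (p ℕ.+ p′ ∸ p) ℕ.+ (r ℕ.+ r′ ∸ r) ℕ.* m
      ∎
  where
  open ≡-Reasoning
  m : ℕ
  m = suc p ℕ.+ p′
  split : ∀ p p′ r r′ → (suc r ℕ.+ r′) ℕ.* (suc p ℕ.+ p′) ≡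
    suc ((p ℕ.+ r ℕ.* (suc p ℕ.+ p′)) ℕ.+ (p′ ℕ.+ r′ ℕ.* (suc p ℕ.+ p′)))
  split = ℕ-solve-∀

complement-digits : ∀ x m i .{{_ : NonZero m}} → i < x ℕ.* m →
  (x ℕ.* m ∸ 1 ∸ i) / m ≡ x ∸ 1 ∸ i / m × (x ℕ.* m ∸ 1 ∸ i) % m ≡ m ∸ 1 ∸ i % m
complement-digits x m i i<xm =
  subst (λ j → j / m ≡ x ∸ 1 ∸ i / m × j % m ≡ m ∸ 1 ∸ i % m) (sym j≡)
    ([p+q*m]/m≡q×[p+q*m]%m≡p (m ∸ 1 ∸ i % m) (x ∸ 1 ∸ i / m) (pred∸<self m (i % m)))
  where
  j≡ : x ℕ.* m ∸ 1 ∸ i ≡ (m ∸ 1 ∸ i % m) ℕ.+ (x ∸ 1 ∸ i / m) ℕ.* m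
  j≡ = trans (cong (λ v → x ℕ.* m ∸ 1 ∸ v) (m≡m%n+[m/n]*n i m))
             (∸-complement-digits {x = x} (m%n<n i m) (m<n*o⇒m/o<n {n = x} i<xm))
  pred∸<self : ∀ m k .{{_ : NonZero m}} → m ∸ 1 ∸ k < m
  pred∸<self (suc m) k = s≤s (ℕP.m∸n≤m m k)

coprime-a⇒coprime-c : ∀ {N a x c} → N ≡ c ℕ.+ x ℕ.* a → suc c ≡ 2 ℕ.* x → Coprime N a → Coprime N c
coprime-a⇒coprime-c {N} {a} {x} {c} N≡ 1+c≡2x coprime-N-a {d} (d∣N , d∣c) = coprime-N-a (d∣N , d∣a)
  where
  d∣xa : d ∣ x ℕ.* a
  d∣xa = ∣m+n∣m⇒∣n (subst (d ∣_) N≡ d∣N) d∣c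
  2xa≡ca+a : 2 ℕ.* (x ℕ.* a) ≡ c ℕ.* a ℕ.+ a
  2xa≡ca+a = trans (sym (ℕP.*-assoc 2 x a))
    (trans (cong (ℕ._* a) (sym 1+c≡2x)) (ℕP.+-comm a (c ℕ.* a)))
  d∣a : d ∣ a
  d∣a = ∣m+n∣m⇒∣n (subst (d ∣_) 2xa≡ca+a (∣n⇒∣m*n 2 d∣xa)) (∣m⇒∣m*n a d∣c)

pos-pred∸ : ∀ {m n} → n < m → + (m ∸ 1 ∸ n) ≡ + m - + 1 - + n
pos-pred∸ {suc m} {n} (s≤s n≤m) = trans (pos-∸ n≤m) (cong (_- + n) (pos-∸ {suc m} (s≤s z≤n)))

1+N≡n⇒0<x : ∀ a x {N} → suc N ≡ nOf a x → 0 < x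
1+N≡n⇒0<x _ (suc _) _ = s≤s z≤n

0<2x : ∀ {x} → 0 < x → 0 < 2 ℕ.* x
0<2x {x} 0<x = ℕP.≤-trans 0<x (ℕP.m≤n*m x 2)

pos-2x∸1 : ∀ {x} → 0 < x → + (2 ℕ.* x ∸ 1) ≡ + 2 * + x - + 1
pos-2x∸1 {x} 0<x = trans (pos-∸ (0<2x 0<x)) (cong (_- + 1) (ℤP.pos-* 2 x))

pos-N : ∀ a x {N} → suc N ≡ nOf a x → + N ≡ + x * (+ a + + 2) - + 1
pos-N a x {N} 1+N≡n = trans (pos-∸ {suc N} (s≤s z≤n)) (cong (_- + 1) n-cast)
  where
  n-cast : + suc N ≡ + x * (+ a + + 2)
  n-cast = trans (cong +_ 1+N≡n) (trans (ℤP.pos-* x (a ℕ.+ 2)) (cong (+ x *_) (ℤP.pos-+ a 2)))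

pos-digits : ∀ a i → + i ≡ + p a i + + r a i * (+ 2 + + a)
pos-digits a i = begin
  + i                                         ≡⟨ cong +_ (m≡m%n+[m/n]*n i (2 ℕ.+ a)) ⟩
  + (p a i ℕ.+ r a i ℕ.* (2 ℕ.+ a))           ≡⟨ ℤP.pos-+ (p a i) _ ⟩
  + p a i + + (r a i ℕ.* (2 ℕ.+ a))           ≡⟨ cong (λ v → + p a i + v) (ℤP.pos-* (r a i) (2 ℕ.+ a)) ⟩
  + p a i + + r a i * + (2 ℕ.+ a)             ≡⟨ cong (λ v → + p a i + + r a i * v) (ℤP.pos-+ 2 a) ⟩
  + p a i + + r a i * (+ 2 + + a)             ∎
  where open ≡-Reasoning

f-digits : ∀ {a x} i → 0 < x → f a x i ≡ + a * + r a i - (+ 2 * + x - + 1) * + p a i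
f-digits {a} {x} i 0<x = cong₂ _-_ (ℤP.pos-* a (r a i))
  (trans (ℤP.pos-* (2 ℕ.* x ∸ 1) (p a i)) (cong (_* + p a i) (pos-2x∸1 0<x)))

f-complement : ∀ a x {N} i → suc N ≡ nOf a x → i ≤ N → f a x (N ∸ i) ≡ - + N - f a x i
f-complement a x {N} i 1+N≡n i≤N = begin
  f a x j
    ≡⟨ f-digits j 0<x ⟩
  + a * + r a j - C * + p a j
    ≡⟨ cong₂ (λ u v → + a * u - C * v) r-j p-j ⟩
  + a * (+ x - + 1 - + r a i) - C * (+ 2 + + a - + 1 - + p a i)
    ≡⟨ identity (+ a) (+ x) (+ r a i) (+ p a i) ⟩
  - (+ x * (+ a + + 2) - + 1) - (+ a * + r a i - C * + p a i)
    ≡⟨ cong₂ (λ u v → - u - v) (pos-N a x 1+N≡n) (f-digits i 0<x) ⟨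
  - + N - f a x i
    ∎
  where
  open ≡-Reasoning
  j : ℕ
  j = N ∸ i
  m : ℕ
  m = 2 ℕ.+ a
  C : ℤ
  C = + 2 * + x - + 1
  0<x : 0 < x
  0<x = 1+N≡n⇒0<x a x 1+N≡n
  1+N≡xm : suc N ≡ x ℕ.* m
  1+N≡xm = trans 1+N≡n (cong (x ℕ.*_) (ℕP.+-comm a 2))
  i<xm : i < x ℕ.* m
  i<xm = subst (i <_) 1+N≡xm (s≤s i≤N)
  digits-j : j / m ≡ x ∸ 1 ∸ r a i × j % m ≡ m ∸ 1 ∸ p a i
  digits-j = subst (λ n → (n ∸ 1 ∸ i) / m ≡ x ∸ 1 ∸ r a i × (n ∸ 1 ∸ i) % m ≡ m ∸ 1 ∸ p a i)
    (sym 1+N≡xm) (complement-digits x m i i<xm)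
  r-j : + r a j ≡ + x - + 1 - + r a i
  r-j = trans (cong +_ (proj₁ digits-j)) (pos-pred∸ (m<n*o⇒m/o<n {n = x} i<xm))
  p-j : + p a j ≡ + 2 + + a - + 1 - + p a i
  p-j = trans (cong +_ (proj₂ digits-j))
    (trans (pos-pred∸ (m%n<n i m)) (cong (λ v → v - + 1 - + p a i) (ℤP.pos-+ 2 a)))
  identity : ∀ A X R P → A * (X - + 1 - R) - (+ 2 * X - + 1) * (+ 2 + A - + 1 - P) ≡
    - (X * (A + + 2) - + 1) - (A * R - (+ 2 * X - + 1) * P)
  identity = solve-∀

N≡[2x∸1]+xa : ∀ a x {N} → suc N ≡ nOf a x → N ≡ (2 ℕ.* x ∸ 1) ℕ.+ x ℕ.* a
N≡[2x∸1]+xa a x {N} 1+N≡n = ℕP.suc-injective (begin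
  suc N                                ≡⟨ 1+N≡n ⟩
  x ℕ.* (a ℕ.+ 2)                      ≡⟨ distribute x a ⟩
  2 ℕ.* x ℕ.+ x ℕ.* a                  ≡⟨ cong (ℕ._+ x ℕ.* a) (ℕP.m+[n∸m]≡n (0<2x 0<x)) ⟨
  suc (2 ℕ.* x ∸ 1) ℕ.+ x ℕ.* a        ∎)
  where
  open ≡-Reasoning
  0<x : 0 < x
  0<x = 1+N≡n⇒0<x a x 1+N≡n
  distribute : ∀ x a → x ℕ.* (a ℕ.+ 2) ≡ 2 ℕ.* x ℕ.+ x ℕ.* a
  distribute = ℕ-solve-∀

f%ℕN≢0 : ∀ a x {N} i .{{_ : NonZero N}} → suc N ≡ nOf a x → Coprime N a → 0 < i → i < N →
  f a x i %ℕ N ≢ 0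
f%ℕN≢0 a x {N} i 1+N≡n coprime-N-a 0<i i<N f%N≡0 =
  ℕP.<⇒≱ i<N (∣⇒≤ {{ℕ.>-nonZero 0<i}} (coprime-divisor coprime-N-c N∣ci))
  where
  open ≡-Reasoning
  0<x : 0 < x
  0<x = 1+N≡n⇒0<x a x 1+N≡n
  c : ℕ
  c = 2 ℕ.* x ∸ 1
  coprime-N-c : Coprime N c
  coprime-N-c =
    coprime-a⇒coprime-c {x = x} (N≡[2x∸1]+xa a x 1+N≡n) (ℕP.m+[n∸m]≡n (0<2x 0<x)) coprime-N-a
  R : ℤ
  R = + r a i
  q : ℤ
  q = f a x i /ℕ N
  identity : ∀ A X R P → A * R - (+ 2 * X - + 1) * P ≡
    + 2 * (X * (A + + 2) - + 1) * R - (+ 2 * X - + 1) * (P + R * (+ 2 + A))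
  identity = solve-∀
  f≡2NR-ci : f a x i ≡ + 2 * + N * R - + c * + i
  f≡2NR-ci = begin
    f a x i                                   ≡⟨ f-digits i 0<x ⟩
    + a * R - (+ 2 * + x - + 1) * + p a i     ≡⟨ identity (+ a) (+ x) R (+ p a i) ⟩
    + 2 * (+ x * (+ a + + 2) - + 1) * R - (+ 2 * + x - + 1) * (+ p a i + R * (+ 2 + + a))
      ≡⟨ cong₂ (λ u v → + 2 * u * R - v) (pos-N a x 1+N≡n) (cong₂ _*_ (pos-2x∸1 0<x) (pos-digits a i)) ⟨
    + 2 * + N * R - + c * + i                 ∎
  f≡qN : f a x i ≡ q * + N
  f≡qN = trans (a≡a%ℕn+[a/ℕn]*n (f a x i) N)
    (trans (cong (λ ρ → + ρ + q * + N) f%N≡0) (ℤP.+-identityˡ (q * + N)))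
  subtract : ∀ U W → W ≡ U - (U - W)
  subtract = solve-∀
  factor : ∀ N R q → + 2 * N * R - q * N ≡ N * (+ 2 * R - q)
  factor = solve-∀
  ci≡N*t : + c * + i ≡ + N * (+ 2 * R - q)
  ci≡N*t = begin
    + c * + i                                  ≡⟨ subtract (+ 2 * + N * R) (+ c * + i) ⟩
    + 2 * + N * R - (+ 2 * + N * R - + c * + i)
      ≡⟨ cong (λ v → + 2 * + N * R - v) (trans (sym f≡2NR-ci) f≡qN) ⟩
    + 2 * + N * R - q * + N                     ≡⟨ factor (+ N) R q ⟩
    + N * (+ 2 * R - q)                         ∎
  N∣ci : N ∣ c ℕ.* i
  N∣ci = divides ℤ.∣ + 2 * R - q ∣ (begin
    c ℕ.* i                     ≡⟨ ℤP.abs-* (+ c) (+ i) ⟨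
    ℤ.∣ + c * + i ∣             ≡⟨ cong ℤ.∣_∣ ci≡N*t ⟩
    ℤ.∣ + N * (+ 2 * R - q) ∣   ≡⟨ ℤP.abs-* (+ N) _ ⟩
    N ℕ.* ℤ.∣ + 2 * R - q ∣     ≡⟨ ℕP.*-comm N _ ⟩
    ℤ.∣ + 2 * R - q ∣ ℕ.* N     ∎)

f-complement-/ℕ : ∀ a x {N} i .{{_ : NonZero N}} → suc N ≡ nOf a x → Coprime N a → 0 < i → i < N →
  f a x (N ∸ i) /ℕ N ≡ - (f a x i /ℕ N) - + 2
f-complement-/ℕ a x {N} i 1+N≡n coprime-N-a 0<i i<N = begin
  f a x (N ∸ i) /ℕ N          ≡⟨ cong (_/ℕ N) (f-complement a x i 1+N≡n (ℕP.<⇒≤ i<N)) ⟩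
  (- + N - f a x i) /ℕ N      ≡⟨ /ℕ-reflect (f a x i) N (f%ℕN≢0 a x i 1+N≡n coprime-N-a 0<i i<N) ⟩
  - (f a x i /ℕ N) - + 2      ∎
  where open ≡-Reasoning

s≡-t⇔2-s≡-[-t-2] : ∀ s t → s ≡ - t ⇔ + 2 - s ≡ - (- t - + 2)
s≡-t⇔2-s≡-[-t-2] s t = mk⇔
  (λ s≡-t → trans (cong (λ v → + 2 - v) s≡-t) (shift t))
  (λ e → trans (involutive s) (trans (cong (λ v → + 2 - v) e) (unshift t)))
  where
  shift : ∀ t → + 2 - (- t) ≡ - (- t - + 2)
  shift = solve-∀
  unshift : ∀ t → + 2 - (- (- t - + 2)) ≡ - t
  unshift = solve-∀
  involutive : ∀ s → s ≡ + 2 - (+ 2 - s)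
  involutive = solve-∀

proposition4p10 : (a x : ℕ) → 3 ≤ a → a ≤ x →
    Coprime (nOf a x ∸ 1) a → Coprime (nOf a x ∸ 1) x →
    (i : ℕ) → 1 ≤ i → i ≤ nOf a x ∸ 2 → (s : ℤ) →
    InF a x s i ⇔ InF a x (+ 2 - s) (nOf a x ∸ 1 ∸ i)
proposition4p10 a x _ _ coprime-n-1-a _ i 1≤i i≤k s =
  subst (λ j → InF a x s i ⇔ InF a x (+ 2 - s) (j ∸ i)) N≡n∸1 (mk⇔ to from)
  where
  k : ℕ
  k = nOf a x ∸ 2
  N : ℕ
  N = suc k
  1+N≡n : suc N ≡ nOf a x
  1+N≡n = ℕP.m+[n∸m]≡n {2} (ℕP.<⇒≤ (ℕP.m∸n≢0⇒n<m (ℕP.m<n⇒n≢0 (ℕP.≤-trans 1≤i i≤k))))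
  N≡n∸1 : N ≡ nOf a x ∸ 1
  N≡n∸1 = cong (_∸ 1) 1+N≡n
  coprime-N-a : Coprime N a
  coprime-N-a = subst (λ n → Coprime n a) (sym N≡n∸1) coprime-n-1-a
  reflect : s ≡ - (f a x i /ℕ N) ⇔ + 2 - s ≡ - (f a x (N ∸ i) /ℕ N)
  reflect = subst (λ t → s ≡ - (f a x i /ℕ N) ⇔ + 2 - s ≡ - t)
    (sym (f-complement-/ℕ a x i 1+N≡n coprime-N-a 1≤i (s≤s i≤k)))
    (s≡-t⇔2-s≡-[-t-2] s (f a x i /ℕ N))
  to : InF a x s i → InF a x (+ 2 - s) (N ∸ i)
  to (_ , _ , e) = ℕP.m<n⇒0<n∸m (s≤s i≤k) , ℕP.∸-monoʳ-≤ N 1≤i , Equivalence.to reflect e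
  from : InF a x (+ 2 - s) (N ∸ i) → InF a x s i
  from (_ , _ , e) = 1≤i , i≤k , Equivalence.from reflect e
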